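{- Let $u,w$ be finite words over the positive integers $\mathbb{P}$, both satisfying the small ascent condition. If $u|^{\{1\}}=w|^{\{1\}}$ and $u|^{\{i,i+1\}}=w|^{\{i,i+1\}}$ for every positive integer $i$, then $u=w$.
   Context: A word $w\in\mathbb{P}^*$ satisfies the small ascent condition if $w(j+1)\le w(j)+1$ for all indices $j$ for which both letters are defined, where $w(j)$ denotes the $j$th letter of $w$. For a set $X$ of letters, $w|^X$ denotes the projection of $w$ onto $X$, i.e., the subword of $w$ consisting of its letters belonging to $X$, in their original order. -}

module Defs where

open import Data.Nat using (ℕ; suc; _≤_; _≟_)
open import Data.List using (List; []; _∷_; filter)
open import Data.List.Relation.Unary.All using (All)
open import Data.Sum using (_⊎_)
open import Relation.Binary.PropositionalEquality using (_≡_)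
open import Relation.Nullary.Decidable using (_⊎-dec_)

IsPWord : List ℕ → Set
IsPWord w = All (1 ≤_) w

data SmallAscent : List ℕ → Set where
  sa-[]  : SmallAscent []
  sa-[x] : ∀ {x} → SmallAscent (x ∷ [])
  sa-∷   : ∀ {x y w} → y ≤ suc x → SmallAscent (y ∷ w) → SmallAscent (x ∷ y ∷ w)

proj₁ₗ : ℕ → List ℕ → List ℕ
proj₁ₗ a w = filter (λ x → x ≟ a) w

proj₂ₗ : ℕ → List ℕ → List ℕ
proj₂ₗ i w = filter (λ x → (x ≟ i) ⊎-dec (x ≟ suc i)) w

-- A small-ascent word over ℙ is recovered from its projections
-- onto the letter pairs {i, i+1} (i ≥ 1).  We induct on the two words and compare their first letters
-- a and b.  If they are equal, the projections of the tails agree as well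
-- (filtering commutes with removing a common first letter).  If, say,
-- a < b = i+1, then a ≤ i, and a small-ascent word starting at a letter ≤ i
-- can climb by at most one per step, so it meets i before it can meet i+1:
-- its projection onto {i, i+1} is empty or begins with i.  The projection of
-- the other word begins with i+1, so the two projections differ.

module Submission where

open import Defs
open import Data.Nat using (ℕ; _≤_)
open import Data.List using (List)
open import Relation.Binary.PropositionalEquality using (_≡_)

open import Data.Nat using (suc; _<_; s≤s; _≟_)
open import Data.Nat.Properties using (<-cmp; ≤-trans; <⇒≢; ≤∧≢⇒<; m<n⇒m<1+n)
open import Data.List using ([]; _∷_; filter)
open import Data.List.Properties using (filter-accept; filter-reject; ∷-injectiveʳ)
open import Data.List.Relation.Unary.All using (_∷_)
open import Data.Sum using (_⊎_; inj₁; inj₂)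
open import Data.Empty using (⊥; ⊥-elim)
open import Relation.Nullary using (¬_; yes; no; contradiction)
open import Relation.Nullary.Decidable using (_⊎-dec_)
open import Relation.Unary using (Pred; Decidable)
open import Relation.Binary using (tri<; tri≈; tri>)
open import Relation.Binary.PropositionalEquality using (refl; sym; trans; cong; subst)

filter-cancel-head : ∀ {a p} {A : Set a} {P : Pred A p} (P? : Decidable P) x xs ys
  → filter P? (x ∷ xs) ≡ filter P? (x ∷ ys) → filter P? xs ≡ filter P? ys
filter-cancel-head P? x xs ys eq with P? x
... | yes _ = ∷-injectiveʳ eq
... | no  _ = eq

InPair? : (i : ℕ) → Decidable (λ x → (x ≡ i) ⊎ (x ≡ suc i))
InPair? i x = (x ≟ i) ⊎-dec (x ≟ suc i)

keep-lower : ∀ i w → proj₂ₗ i (i ∷ w) ≡ i ∷ proj₂ₗ i w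
keep-lower i w = filter-accept (InPair? i) (inj₁ refl)

keep-upper : ∀ i w → proj₂ₗ i (suc i ∷ w) ≡ suc i ∷ proj₂ₗ i w
keep-upper i w = filter-accept (InPair? i) (inj₂ refl)

below-pair : ∀ {a i} → a < i → ¬ ((a ≡ i) ⊎ (a ≡ suc i))
below-pair a<i (inj₁ a≡i)  = <⇒≢ a<i a≡i
below-pair a<i (inj₂ a≡1+i) = <⇒≢ (m<n⇒m<1+n a<i) a≡1+i

data EmptyOrHead (x : ℕ) : List ℕ → Set where
  empty : EmptyOrHead x []
  head  : ∀ {l} → EmptyOrHead x (x ∷ l)

-- Climbing lemma: a small-ascent word starting at a letter ≤ i reaches i
-- before i+1, so its projection onto {i, i+1} is empty or starts with i.
climb : ∀ {i a v} → SmallAscent (a ∷ v) → a ≤ i → EmptyOrHead i (proj₂ₗ i (a ∷ v))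
climb {i} {a} {v} sa a≤i with a ≟ i
... | yes refl = subst (EmptyOrHead i) (sym (keep-lower i v)) head
... | no  a≢i  = subst (EmptyOrHead i) (sym (filter-reject (InPair? i) (below-pair a<i)))
                       (climb-tail sa)
  where
  a<i : a < i
  a<i = ≤∧≢⇒< a≤i a≢i

  -- The next letter is at most a+1 ≤ i, so the lemma applies to the tail.
  climb-tail : SmallAscent (a ∷ v) → EmptyOrHead i (proj₂ₗ i v)
  climb-tail sa-[x]         = empty
  climb-tail (sa-∷ y≤1+a sa′) = climb sa′ (≤-trans y≤1+a a<i)

separated : ∀ {i a u w} → SmallAscent (a ∷ u) → a ≤ i
  → proj₂ₗ i (a ∷ u) ≡ proj₂ₗ i (suc i ∷ w) → ⊥
separated {i} {w = w} sa a≤i eq =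
  not-upper (subst (EmptyOrHead i) (trans eq (keep-upper i w)) (climb sa a≤i))
  where
  not-upper : ∀ {l} → ¬ EmptyOrHead i (suc i ∷ l)
  not-upper ()

PairsAgree : List ℕ → List ℕ → Set
PairsAgree u w = (i : ℕ) → 1 ≤ i → proj₂ₗ i u ≡ proj₂ₗ i w

smaller-head-disagrees : ∀ {a b u w} → 1 ≤ a → SmallAscent (a ∷ u) → a < b
  → ¬ PairsAgree (a ∷ u) (b ∷ w)
smaller-head-disagrees 1≤a sa (s≤s {n = i} a≤i) agree =
  separated sa a≤i (agree i (≤-trans 1≤a a≤i))

pairs-determine : ∀ u w → IsPWord u → IsPWord w → SmallAscent u → SmallAscent w
  → PairsAgree u w → u ≡ w
pairs-determine []      []      _ _ _ _ _ = refl
pairs-determine []      (b ∷ w) _ (1≤b ∷ _) _ _ agree =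
  contradiction (trans (agree b 1≤b) (keep-lower b w)) λ ()
pairs-determine (a ∷ u) []      (1≤a ∷ _) _ _ _ agree =
  contradiction (trans (sym (agree a 1≤a)) (keep-lower a u)) λ ()
pairs-determine (a ∷ u) (b ∷ w) (1≤a ∷ pu) (1≤b ∷ pw) sau saw agree with <-cmp a b
... | tri< a<b _ _ = ⊥-elim (smaller-head-disagrees 1≤a sau a<b agree)
... | tri> _ _ b<a = ⊥-elim (smaller-head-disagrees 1≤b saw b<a (λ i 1≤i → sym (agree i 1≤i)))
... | tri≈ _ refl _ = cong (a ∷_) (pairs-determine u w pu pw (tail sau) (tail saw) agree-tails)
  where
  tail : ∀ {x v} → SmallAscent (x ∷ v) → SmallAscent v
  tail sa-[x]      = sa-[]
  tail (sa-∷ _ sa) = sa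

  agree-tails : PairsAgree u w
  agree-tails i 1≤i = filter-cancel-head (InPair? i) a u w (agree i 1≤i)

-- Proposition 3.1.
proposition3p1 : (u w : List ℕ) → IsPWord u → IsPWord w
    → SmallAscent u → SmallAscent w
    → proj₁ₗ 1 u ≡ proj₁ₗ 1 w
    → ((i : ℕ) → 1 ≤ i → proj₂ₗ i u ≡ proj₂ₗ i w)
    → u ≡ w
proposition3p1 u w pu pw sau saw _ pairs = pairs-determine u w pu pw sau saw pairs
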